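{- Let $G$ be a $C_4$-free graph on $n\ge 1$ vertices with minimum degree $\delta(G)$. Then $\omega(G)\ge \frac{\delta(G)^2}{2n+\delta(G)}$.
   Context: All graphs are finite and simple. A graph is called $C_4$-free if it does not contain the cycle on four vertices as an induced subgraph. $\omega(G)$ denotes the maximum size of a clique (complete subgraph) in $G$, and $\delta(G)$ denotes the minimum degree of $G$. -}

module Defs where

open import Data.Nat using (ℕ; zero; suc; _+_; _*_; _≤_; _⊔_)
open import Data.Bool using (Bool; true; false; if_then_else_)
open import Data.Fin using (Fin; zero; suc)
open import Data.Vec.Functional using (Vector)
open import Relation.Binary.PropositionalEquality using (_≡_; _≢_)
open import Data.Product using (Σ; _×_; ∃-syntax)
open import Function.Definitions using (Injective)
open import Data.Empty using (⊥)

record Graph (n : ℕ) : Set where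
  field
    adj     : Fin n → Fin n → Bool
    symm    : ∀ u v → adj u v ≡ adj v u
    irrefl  : ∀ v → adj v v ≡ false

open Graph public

Adj : ∀ {n} → Graph n → Fin n → Fin n → Set
Adj G u v = adj G u v ≡ true

count : ∀ {m} → (Fin m → Bool) → ℕ
count {zero}  f = 0
count {suc m} f = (if f zero then 1 else 0) + count {m} (λ i → f (suc i))

degree : ∀ {n} → Graph n → Fin n → ℕ
degree G v = count (adj G v)

minFin : ∀ {m} → (Fin (suc m) → ℕ) → ℕ
minFin {zero}  f = f zero
minFin {suc m} f = Data.Nat._⊓_ (f zero) (minFin {m} (λ i → f (suc i)))

minDegree : ∀ {n} → Graph (suc n) → ℕ
minDegree G = minFin (degree G)

C4Free : ∀ {n} → Graph n → Set
C4Free G = ∀ a b c d →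
  a ≢ b → a ≢ c → a ≢ d → b ≢ c → b ≢ d → c ≢ d →
  Adj G a b → Adj G b c → Adj G c d → Adj G d a →
  adj G a c ≡ false → adj G b d ≡ false → ⊥

IsClique : ∀ {n k} → Graph n → Vector (Fin n) k → Set
IsClique G vs = Injective _≡_ _≡_ vs × (∀ i j → i ≢ j → Adj G (vs i) (vs j))

HasClique : ∀ {n} → Graph n → ℕ → Set
HasClique {n} G k = Σ (Vector (Fin n) k) (IsClique G)

-- Key fact: in a C4-free graph the common neighbourhood of two distinct
-- non-adjacent vertices is a clique, hence has at most ω elements.  Fix a
-- maximum independent set I = {v₁, …, v_ℓ}.
--   (A) δ ≤ ℓ ω.  N(v₁) splits into its private part (neighbours of v₁
--       adjacent to no other vᵢ), which is a clique by maximality of I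
--       (two non-adjacent private neighbours could replace v₁ in I), and
--       ⋃ᵢ N(v₁) ∩ N(vᵢ), a union of ℓ - 1 cliques.
--   (B) s δ ≤ N + (s C 2) ω for s ≤ ℓ, by Bonferroni's inequality applied
--       to the neighbourhoods of v₁, …, v_s.
-- An arithmetic lemma turns (A) and (B) into δ² ≤ ω (2N + δ).
module Submission where

open import Defs
open import Data.Nat using (ℕ; zero; suc; _+_; _*_; _≤_; _<_; z≤n; _≤?_; _<?_)
open import Data.Nat.Properties
  using (module ≤-Reasoning; +-suc; +-assoc; +-mono-≤; +-monoˡ-≤; +-monoʳ-≤; +-monoˡ-<; +-cancelˡ-<;
         *-assoc; *-distribʳ-+; *-monoˡ-≤; *-monoʳ-≤; *-cancelˡ-<; ≤-refl; ≤-reflexive; ≤-trans;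
         <⇒≤; <⇒≱; ≮⇒≥; ≰⇒>; n<1+n; n≤1+n; m≤m+n; m≤n⇒m⊓n≡m; m⊓n≤m; m⊓n≤n)
open import Data.Nat.Combinatorics using (_C_; nC1≡n; nCk+nC[k+1]≡[n+1]C[k+1])
open import Data.Nat.Tactic.RingSolver using (solve-∀)
open import Data.Bool using (Bool; true; false)
import Data.Bool as Bool
open import Data.Bool.Properties using (¬-not)
open import Data.Fin using (Fin; zero; suc; fromℕ<; _≟_)
open import Data.Fin.Properties using (decFinSubset; suc-injective)
import Data.Fin.Properties as Fin
open import Data.Fin.Subset
  using (Subset; inside; outside; _∈_; _∉_; _⊆_; _∪_; _∩_; _─_; _-_; ⁅_⁆; ⋃; ∣_∣)
  renaming (⊥ to ∅)
open import Data.Fin.Subset.Properties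
  using (_∈?_; anySubset?; ∉⊥; ∣⊥∣≡0; ∣p∣≤n; ∣p∩q∣≤∣q∣; p─⊥≡p; ∪-identityʳ; ∩-distribˡ-∪;
         x∈p∪q⁺; x∈p∪q⁻; x∈p∩q⁻; x∈⁅y⁆⇒x≡y; ∣⁅x⁆∣≡1; x∉⁅y⁆⇒x≢y; p─q⊆p)
open import Data.Vec using ([]; _∷_; tabulate; here; there)
open import Data.Vec.Properties using (lookup∘tabulate; []=⇒lookup; lookup⇒[]=)
open import Data.List using (List; []; _∷_; map; length; take)
import Data.List as List
open import Data.List.Properties using (length-map; length-take)
open import Data.List.Membership.Propositional using () renaming (_∈_ to _∈ˡ_)
open import Data.List.Membership.Propositional.Properties using (∈-map⁺; ∈-tabulate⁺; ∈-tabulate⁻)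
import Data.List.Relation.Unary.Any as Any
open import Data.List.Relation.Unary.All using (All; []; _∷_; universal)
import Data.List.Relation.Unary.All.Properties as All
open import Data.List.Relation.Unary.AllPairs using (AllPairs; []; _∷_)
import Data.List.Relation.Unary.AllPairs.Properties as AllPairs
open import Data.Product using (Σ; ∃; _×_; _,_; proj₁; proj₂)
import Data.Product as Product
open import Data.Sum using (inj₁; inj₂)
open import Data.Empty using (⊥-elim)
open import Function using (_∘_; id)
open import Relation.Nullary using (¬_; yes; no; ¬?; _×-dec_; _→-dec_)
open import Relation.Unary using (Pred; Decidable)
open import Relation.Binary.PropositionalEquality

private
  variable
    n : ℕ

∣tabulate∣≡count : (f : Fin n → Bool) → ∣ tabulate f ∣ ≡ count f
∣tabulate∣≡count {zero}  f = refl
∣tabulate∣≡count {suc n} f with f zero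
... | true  = cong suc (∣tabulate∣≡count (f ∘ suc))
... | false = ∣tabulate∣≡count (f ∘ suc)

∣p∪q∣+∣p∩q∣≡∣p∣+∣q∣ : (p q : Subset n) → ∣ p ∪ q ∣ + ∣ p ∩ q ∣ ≡ ∣ p ∣ + ∣ q ∣
∣p∪q∣+∣p∩q∣≡∣p∣+∣q∣ []            []            = refl
∣p∪q∣+∣p∩q∣≡∣p∣+∣q∣ (inside ∷ p)  (inside ∷ q)  =
  cong suc (trans (+-suc _ _) (trans (cong suc (∣p∪q∣+∣p∩q∣≡∣p∣+∣q∣ p q)) (sym (+-suc _ _))))
∣p∪q∣+∣p∩q∣≡∣p∣+∣q∣ (inside ∷ p)  (outside ∷ q) = cong suc (∣p∪q∣+∣p∩q∣≡∣p∣+∣q∣ p q)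
∣p∪q∣+∣p∩q∣≡∣p∣+∣q∣ (outside ∷ p) (inside ∷ q)  =
  trans (cong suc (∣p∪q∣+∣p∩q∣≡∣p∣+∣q∣ p q)) (sym (+-suc _ _))
∣p∪q∣+∣p∩q∣≡∣p∣+∣q∣ (outside ∷ p) (outside ∷ q) = ∣p∪q∣+∣p∩q∣≡∣p∣+∣q∣ p q

∣p∪q∣≤∣p∣+∣q∣ : (p q : Subset n) → ∣ p ∪ q ∣ ≤ ∣ p ∣ + ∣ q ∣
∣p∪q∣≤∣p∣+∣q∣ p q = ≤-trans (m≤m+n _ _) (≤-reflexive (∣p∪q∣+∣p∩q∣≡∣p∣+∣q∣ p q))

∣p∣≡∣p─q∣+∣p∩q∣ : (p q : Subset n) → ∣ p ∣ ≡ ∣ p ─ q ∣ + ∣ p ∩ q ∣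
∣p∣≡∣p─q∣+∣p∩q∣ []            []            = refl
∣p∣≡∣p─q∣+∣p∩q∣ (inside ∷ p)  (inside ∷ q)  =
  trans (cong suc (∣p∣≡∣p─q∣+∣p∩q∣ p q)) (sym (+-suc _ _))
∣p∣≡∣p─q∣+∣p∩q∣ (inside ∷ p)  (outside ∷ q) = cong suc (∣p∣≡∣p─q∣+∣p∩q∣ p q)
∣p∣≡∣p─q∣+∣p∩q∣ (outside ∷ p) (inside ∷ q)  = ∣p∣≡∣p─q∣+∣p∩q∣ p q
∣p∣≡∣p─q∣+∣p∩q∣ (outside ∷ p) (outside ∷ q) = ∣p∣≡∣p─q∣+∣p∩q∣ p q

x∈p─q⇒x∉q : ∀ {x} {p q : Subset n} → x ∈ p ─ q → x ∉ q
x∈p─q⇒x∉q {p = _ ∷ _} {outside ∷ _} here        ()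
x∈p─q⇒x∉q {p = _ ∷ _} {_ ∷ _}       (there x∈) (there x∈q) = x∈p─q⇒x∉q x∈ x∈q

∣p∣≡1+∣p-x∣ : ∀ {x} {p : Subset n} → x ∈ p → ∣ p ∣ ≡ suc ∣ p - x ∣
∣p∣≡1+∣p-x∣ {p = inside ∷ p}  here      = cong suc (sym (cong ∣_∣ (p─⊥≡p p)))
∣p∣≡1+∣p-x∣ {p = inside ∷ p}  (there x∈) = cong suc (∣p∣≡1+∣p-x∣ x∈)
∣p∣≡1+∣p-x∣ {p = outside ∷ p} (there x∈) = ∣p∣≡1+∣p-x∣ x∈

∣p∪⁅x⁆∣≡1+∣p∣ : ∀ {x} {p : Subset n} → x ∉ p → ∣ p ∪ ⁅ x ⁆ ∣ ≡ suc ∣ p ∣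
∣p∪⁅x⁆∣≡1+∣p∣ {x = zero}  {inside ∷ p}  x∉ = ⊥-elim (x∉ here)
∣p∪⁅x⁆∣≡1+∣p∣ {x = zero}  {outside ∷ p} x∉ = cong suc (cong ∣_∣ (∪-identityʳ p))
∣p∪⁅x⁆∣≡1+∣p∣ {x = suc x} {inside ∷ p}  x∉ = cong suc (∣p∪⁅x⁆∣≡1+∣p∣ (x∉ ∘ there))
∣p∪⁅x⁆∣≡1+∣p∣ {x = suc x} {outside ∷ p} x∉ = ∣p∪⁅x⁆∣≡1+∣p∣ (x∉ ∘ there)

x∈⋃ : ∀ {x} {q : Subset n} {qs} → x ∈ q → q ∈ˡ qs → x ∈ ⋃ qs
x∈⋃ x∈q (Any.here refl) = x∈p∪q⁺ (inj₁ x∈q)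
x∈⋃ x∈q (Any.there q∈)  = x∈p∪q⁺ (inj₂ (x∈⋃ x∈q q∈))

∣p∩⋃qs∣≤ : ∀ {c} (p : Subset n) qs → All (λ q → ∣ p ∩ q ∣ ≤ c) qs → ∣ p ∩ ⋃ qs ∣ ≤ length qs * c
∣p∩⋃qs∣≤ {n} p []       []       = ≤-trans (∣p∩q∣≤∣q∣ p ∅) (≤-reflexive (∣⊥∣≡0 n))
∣p∩⋃qs∣≤ {c = c} p (q ∷ qs) (b ∷ bs) = begin
  ∣ p ∩ (q ∪ ⋃ qs) ∣           ≡⟨ cong ∣_∣ (∩-distribˡ-∪ p q (⋃ qs)) ⟩
  ∣ (p ∩ q) ∪ (p ∩ ⋃ qs) ∣     ≤⟨ ∣p∪q∣≤∣p∣+∣q∣ (p ∩ q) (p ∩ ⋃ qs) ⟩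
  ∣ p ∩ q ∣ + ∣ p ∩ ⋃ qs ∣     ≤⟨ +-mono-≤ b (∣p∩⋃qs∣≤ p qs bs) ⟩
  c + length qs * c            ∎
  where open ≤-Reasoning

-- Pascal's rule for pairs: a new object forms a pair with each old one.
C2-suc : ∀ k → suc k C 2 ≡ k + k C 2
C2-suc k = trans (sym (nCk+nC[k+1]≡[n+1]C[k+1] k 1)) (cong (_+ k C 2) (nC1≡n k))

bonferroni : ∀ {c d} (ps : List (Subset n)) → All (λ p → d ≤ ∣ p ∣) ps →
             AllPairs (λ p q → ∣ p ∩ q ∣ ≤ c) ps →
             length ps * d ≤ ∣ ⋃ ps ∣ + (length ps C 2) * c
bonferroni []       []       []         = z≤n
bonferroni {c = c} {d} (p ∷ ps) (d≤p ∷ d≤ps) (meets ∷ pairs) = begin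
  d + ℓ * d                                   ≤⟨ +-mono-≤ d≤p (bonferroni ps d≤ps pairs) ⟩
  ∣ p ∣ + (∣ ⋃ ps ∣ + (ℓ C 2) * c)            ≡⟨ sym (+-assoc ∣ p ∣ _ _) ⟩
  (∣ p ∣ + ∣ ⋃ ps ∣) + (ℓ C 2) * c            ≡⟨ cong (_+ (ℓ C 2) * c) (sym (∣p∪q∣+∣p∩q∣≡∣p∣+∣q∣ p (⋃ ps))) ⟩
  (∣ p ∪ ⋃ ps ∣ + ∣ p ∩ ⋃ ps ∣) + (ℓ C 2) * c ≤⟨ +-monoˡ-≤ _ (+-monoʳ-≤ ∣ p ∪ ⋃ ps ∣ (∣p∩⋃qs∣≤ p ps meets)) ⟩
  (∣ p ∪ ⋃ ps ∣ + ℓ * c) + (ℓ C 2) * c        ≡⟨ +-assoc ∣ p ∪ ⋃ ps ∣ _ _ ⟩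
  ∣ p ∪ ⋃ ps ∣ + (ℓ * c + (ℓ C 2) * c)        ≡⟨ cong (∣ p ∪ ⋃ ps ∣ +_) (sym (*-distribʳ-+ c ℓ (ℓ C 2))) ⟩
  ∣ p ∪ ⋃ ps ∣ + (ℓ + ℓ C 2) * c              ≡⟨ cong (λ k → ∣ p ∪ ⋃ ps ∣ + k * c) (sym (C2-suc ℓ)) ⟩
  ∣ p ∪ ⋃ ps ∣ + (suc ℓ C 2) * c              ∎
  where
  open ≤-Reasoning
  ℓ = length ps

maximum : ∀ {ℓ} {P : Pred (Subset n) ℓ} → Decidable P → ∀ {p} → P p →
          ∃ λ q → P q × (∀ {r} → P r → ∣ r ∣ ≤ ∣ q ∣)
maximum {n} {P = P} P? {p} Pp = climb n Pp (m≤m+n n ∣ p ∣)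
  where
  -- d bounds how often the current set can still be enlarged.
  climb : ∀ d {p} → P p → n ≤ d + ∣ p ∣ → ∃ λ q → P q × (∀ {r} → P r → ∣ r ∣ ≤ ∣ q ∣)
  climb d {p} Pp n≤ with anySubset? (λ r → P? r ×-dec (∣ p ∣ <? ∣ r ∣))
  climb d       Pp n≤ | no ∄larger = _ , Pp , λ Pr → ≮⇒≥ (λ p<r → ∄larger (_ , Pr , p<r))
  climb zero    Pp n≤ | yes (r , Pr , p<r) = ⊥-elim (<⇒≱ p<r (≤-trans (∣p∣≤n r) n≤))
  climb (suc d) {p} Pp n≤ | yes (r , Pr , p<r) =
    climb d Pr (≤-trans n≤ (≤-trans (≤-reflexive (sym (+-suc d ∣ p ∣))) (+-monoʳ-≤ d p<r)))

enum : (p : Subset n) → Fin ∣ p ∣ → Fin n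
enum (inside ∷ p)  zero    = zero
enum (inside ∷ p)  (suc i) = suc (enum p i)
enum (outside ∷ p) i       = suc (enum p i)

enum-∈ : (p : Subset n) (i : Fin ∣ p ∣) → enum p i ∈ p
enum-∈ (inside ∷ p)  zero    = here
enum-∈ (inside ∷ p)  (suc i) = there (enum-∈ p i)
enum-∈ (outside ∷ p) i       = there (enum-∈ p i)

enum-injective : (p : Subset n) → ∀ {i j} → enum p i ≡ enum p j → i ≡ j
enum-injective (inside ∷ p)  {zero}  {zero}  _ = refl
enum-injective (inside ∷ p)  {suc i} {suc j} e = cong suc (enum-injective p (suc-injective e))
enum-injective (outside ∷ p) e = enum-injective p (suc-injective e)

enum-surjective : (p : Subset n) → ∀ {x} → x ∈ p → ∃ λ i → enum p i ≡ x
enum-surjective (inside ∷ p)  here      = zero , refl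
enum-surjective (inside ∷ p)  (there x∈) = Product.map suc (cong suc) (enum-surjective p x∈)
enum-surjective (outside ∷ p) (there x∈) = Product.map id (cong suc) (enum-surjective p x∈)

C2-double : ∀ s → suc s C 2 + suc s C 2 ≡ suc s * s
C2-double zero    = refl
C2-double (suc s) = begin
  suc (suc s) C 2 + suc (suc s) C 2                 ≡⟨ cong (λ k → k + k) (C2-suc (suc s)) ⟩
  (suc s + suc s C 2) + (suc s + suc s C 2)         ≡⟨ regroup (suc s) (suc s C 2) ⟩
  suc s + suc s + (suc s C 2 + suc s C 2)           ≡⟨ cong (suc s + suc s +_) (C2-double s) ⟩
  suc s + suc s + suc s * s                         ≡⟨ expand s ⟩
  suc (suc s) * suc s                               ∎
  where
  open ≡-Reasoning
  regroup : ∀ a c → (a + c) + (a + c) ≡ a + a + (c + c)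
  regroup = solve-∀
  expand : ∀ s → suc s + suc s + suc s * s ≡ suc (suc s) * suc s
  expand = solve-∀

-- If t = suc s objects satisfy Bonferroni's bound yet t δ exceeds 2N, then
-- δ < s ω:  2 t δ ≤ 2N + t s ω < t δ + t s ω.
crossing-step : ∀ {N δ ω} s → 2 * N < suc s * δ → suc s * δ ≤ N + (suc s C 2) * ω → δ < s * ω
crossing-step {N} {δ} {ω} s 2N<tδ tδ≤ =
  *-cancelˡ-< t δ (s * ω) (+-cancelˡ-< (t * δ) (t * δ) (t * (s * ω)) (begin-strict
    t * δ + t * δ                     ≤⟨ +-mono-≤ tδ≤ tδ≤ ⟩
    (N + c * ω) + (N + c * ω)         ≡⟨ regroup N c ω ⟩
    2 * N + (c + c) * ω               ≡⟨ cong (λ k → 2 * N + k * ω) (C2-double s) ⟩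
    2 * N + t * s * ω                 <⟨ +-monoˡ-< (t * s * ω) 2N<tδ ⟩
    t * δ + t * s * ω                 ≡⟨ cong (t * δ +_) (*-assoc t s ω) ⟩
    t * δ + t * (s * ω)               ∎))
  where
  open ≤-Reasoning
  t = suc s
  c = suc s C 2
  regroup : ∀ N c ω → (N + c * ω) + (N + c * ω) ≡ 2 * N + (c + c) * ω
  regroup = solve-∀

-- From δ ≤ ℓ ω and Bonferroni's bound for every s ≤ ℓ, deduce δ² ≤ ω(2N+δ):
-- some s satisfies δ ≤ s ω and s δ ≤ 2N (s = ℓ, or the last s before s δ
-- exceeds 2N), and then δ² ≤ s ω δ ≤ 2N ω.
clique-arithmetic : ∀ {N δ ω} ℓ → δ ≤ ℓ * ω → (∀ s → s ≤ ℓ → s * δ ≤ N + (s C 2) * ω) →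
                    δ * δ ≤ ω * (2 * N + δ)
clique-arithmetic {N} {δ} {ω} ℓ δ≤ℓω bonf = from-witness witness
  where
  Witness : Set
  Witness = ∃ λ s → δ ≤ s * ω × s * δ ≤ 2 * N

  from-witness : Witness → δ * δ ≤ ω * (2 * N + δ)
  from-witness (s , δ≤sω , sδ≤2N) = begin
    δ * δ             ≤⟨ *-monoˡ-≤ δ δ≤sω ⟩
    s * ω * δ         ≡⟨ rearrange s ω δ ⟩
    ω * (s * δ)       ≤⟨ *-monoʳ-≤ ω sδ≤2N ⟩
    ω * (2 * N)       ≤⟨ *-monoʳ-≤ ω (m≤m+n (2 * N) δ) ⟩
    ω * (2 * N + δ)   ∎
    where
    open ≤-Reasoning
    rearrange : ∀ s ω δ → s * ω * δ ≡ ω * (s * δ)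
    rearrange = solve-∀

  crossing : ∀ t → t ≤ ℓ → 2 * N < t * δ → Witness
  crossing zero    _   ()
  crossing (suc s) t≤ℓ 2N<tδ with s * δ ≤? 2 * N
  ... | yes sδ≤2N = s , <⇒≤ (crossing-step s 2N<tδ (bonf (suc s) t≤ℓ)) , sδ≤2N
  ... | no  sδ≰2N = crossing s (≤-trans (n≤1+n s) t≤ℓ) (≰⇒> sδ≰2N)

  witness : Witness
  witness with ℓ * δ ≤? 2 * N
  ... | yes ℓδ≤2N = ℓ , δ≤ℓω , ℓδ≤2N
  ... | no  ℓδ≰2N = crossing ℓ ≤-refl (≰⇒> ℓδ≰2N)

minFin-≤ : ∀ {m} (f : Fin (suc m) → ℕ) i → minFin f ≤ f i
minFin-≤ {zero}  f zero    = ≤-refl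
minFin-≤ {suc m} f zero    = m⊓n≤m _ _
minFin-≤ {suc m} f (suc i) = ≤-trans (m⊓n≤n _ _) (minFin-≤ (f ∘ suc) i)

NonAdj : Graph n → Fin n → Fin n → Set
NonAdj G x y = adj G x y ≡ false

module GraphFacts (G : Graph n) where

  N : Fin n → Subset n
  N v = tabulate (adj G v)

  ∈N⁺ : ∀ {v x} → Adj G v x → x ∈ N v
  ∈N⁺ {v} {x} v~x = lookup⇒[]= x (N v) (trans (lookup∘tabulate (adj G v) x) v~x)

  ∈N⁻ : ∀ {v x} → x ∈ N v → Adj G v x
  ∈N⁻ {v} {x} x∈ = trans (sym (lookup∘tabulate (adj G v) x)) ([]=⇒lookup x∈)

  ∣N∣≡degree : ∀ v → ∣ N v ∣ ≡ degree G v
  ∣N∣≡degree v = ∣tabulate∣≡count (adj G v)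

  Adj-sym : ∀ {x y} → Adj G x y → Adj G y x
  Adj-sym {x} {y} x~y = trans (symm G y x) x~y

  NonAdj-sym : ∀ {x y} → NonAdj G x y → NonAdj G y x
  NonAdj-sym {x} {y} x≁y = trans (symm G y x) x≁y

  Adj⇒≢ : ∀ {x y} → Adj G x y → x ≢ y
  Adj⇒≢ {x} x~x refl with () ← trans (sym x~x) (irrefl G x)

  ¬Adj⇒NonAdj : ∀ {x y} → ¬ Adj G x y → NonAdj G x y
  ¬Adj⇒NonAdj = ¬-not

  CliqueSet : Subset n → Set
  CliqueSet p = ∀ {x} → x ∈ p → ∀ {y} → y ∈ p → x ≢ y → Adj G x y

  IndependentSet : Subset n → Set
  IndependentSet p = ∀ {x} → x ∈ p → ∀ {y} → y ∈ p → NonAdj G x y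

  cliqueSet? : Decidable CliqueSet
  cliqueSet? p = decFinSubset (_∈? p) λ {x} _ → decFinSubset (_∈? p) λ {y} _ →
    ¬? (x ≟ y) →-dec (adj G x y Bool.≟ true)

  independentSet? : Decidable IndependentSet
  independentSet? p = decFinSubset (_∈? p) λ {x} _ → decFinSubset (_∈? p) λ {y} _ →
    adj G x y Bool.≟ false

  cliqueSet⇒HasClique : ∀ {p} → CliqueSet p → HasClique G ∣ p ∣
  cliqueSet⇒HasClique {p} K =
    enum p , enum-injective p , λ i j i≢j → K (enum-∈ p i) (enum-∈ p j) (i≢j ∘ enum-injective p)

  singleton-independent : ∀ a → IndependentSet ⁅ a ⁆
  singleton-independent a x∈ y∈ rewrite x∈⁅y⁆⇒x≡y a x∈ | x∈⁅y⁆⇒x≡y a y∈ = irrefl G a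

  independent-⊆ : ∀ {p q} → p ⊆ q → IndependentSet q → IndependentSet p
  independent-⊆ p⊆q I x∈ y∈ = I (p⊆q x∈) (p⊆q y∈)

  independent-∪⁅⁆ : ∀ {p a} → IndependentSet p → (∀ {x} → x ∈ p → NonAdj G a x) →
                    IndependentSet (p ∪ ⁅ a ⁆)
  independent-∪⁅⁆ {p} {a} I a≁ x∈ y∈ with x∈p∪q⁻ p ⁅ a ⁆ x∈ | x∈p∪q⁻ p ⁅ a ⁆ y∈
  ... | inj₁ x∈p | inj₁ y∈p = I x∈p y∈p
  ... | inj₁ x∈p | inj₂ y∈a rewrite x∈⁅y⁆⇒x≡y a y∈a = NonAdj-sym (a≁ x∈p)
  ... | inj₂ x∈a | inj₁ y∈p rewrite x∈⁅y⁆⇒x≡y a x∈a = a≁ y∈p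
  ... | inj₂ x∈a | inj₂ y∈a rewrite x∈⁅y⁆⇒x≡y a x∈a | x∈⁅y⁆⇒x≡y a y∈a = irrefl G a

  -- In a C4-free graph the common neighbourhood of two distinct non-adjacent
  -- vertices is a clique: two non-adjacent common neighbours would span an
  -- induced C4.
  common-neighbourhood-clique : C4Free G → ∀ {x y} → x ≢ y → NonAdj G x y → CliqueSet (N x ∩ N y)
  common-neighbourhood-clique c4 {x} {y} x≢y x≁y {a} a∈ {b} b∈ a≢b with adj G a b in a~b
  ... | true  = refl
  ... | false = ⊥-elim (c4 x a y b (Adj⇒≢ x~a) x≢y (Adj⇒≢ x~b) (Adj⇒≢ (Adj-sym y~a)) a≢b (Adj⇒≢ y~b)
                          x~a (Adj-sym y~a) y~b (Adj-sym x~b) x≁y a~b)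
    where
    x~a = ∈N⁻ (proj₁ (x∈p∩q⁻ (N x) (N y) a∈))
    y~a = ∈N⁻ (proj₂ (x∈p∩q⁻ (N x) (N y) a∈))
    x~b = ∈N⁻ (proj₁ (x∈p∩q⁻ (N x) (N y) b∈))
    y~b = ∈N⁻ (proj₂ (x∈p∩q⁻ (N x) (N y) b∈))

module Bound {m : ℕ} (G : Graph (suc m)) (c4 : C4Free G) where
  open GraphFacts G

  δ : ℕ
  δ = minDegree G

  δ≤∣N∣ : ∀ v → δ ≤ ∣ N v ∣
  δ≤∣N∣ v = ≤-trans (minFin-≤ (degree G) v) (≤-reflexive (sym (∣N∣≡degree v)))

  maxClique : ∃ λ K → CliqueSet K × (∀ {p} → CliqueSet p → ∣ p ∣ ≤ ∣ K ∣)
  maxClique = maximum cliqueSet? {∅} (λ x∈∅ → ⊥-elim (∉⊥ x∈∅))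

  K : Subset (suc m)
  K = proj₁ maxClique

  K-clique : CliqueSet K
  K-clique = proj₁ (proj₂ maxClique)

  ω : ℕ
  ω = ∣ K ∣

  ω-max : ∀ {p} → CliqueSet p → ∣ p ∣ ≤ ω
  ω-max = proj₂ (proj₂ maxClique)

  Meet≤ω : Fin (suc m) → Fin (suc m) → Set
  Meet≤ω x y = ∣ N x ∩ N y ∣ ≤ ω

  meet≤ω : ∀ {x y} → x ≢ y → NonAdj G x y → Meet≤ω x y
  meet≤ω x≢y x≁y = ω-max (common-neighbourhood-clique c4 x≢y x≁y)

  maxIndependent : ∃ λ I → IndependentSet I × (∀ {p} → IndependentSet p → ∣ p ∣ ≤ ∣ I ∣)
  maxIndependent = maximum independentSet? (singleton-independent zero)

  I : Subset (suc m)
  I = proj₁ maxIndependent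

  I-independent : IndependentSet I
  I-independent = proj₁ (proj₂ maxIndependent)

  I-max : ∀ {p} → IndependentSet p → ∣ p ∣ ≤ ∣ I ∣
  I-max = proj₂ (proj₂ maxIndependent)

  I-nonempty : 0 < ∣ I ∣
  I-nonempty = ≤-trans (≤-reflexive (sym (∣⁅x⁆∣≡1 {suc m} zero))) (I-max (singleton-independent zero))

  -- The private neighbourhood of v ∈ I (neighbours of v adjacent to no other
  -- member of I) is a clique: two non-adjacent private neighbours w, w'
  -- would make (I - v) ∪ {w, w'} a larger independent set.
  private-clique : ∀ {v others} → v ∈ I → (∀ {x} → x ∈ I → x ≢ v → x ∈ˡ others) →
                   CliqueSet (N v ─ ⋃ (map N others))
  private-clique {v} {others} v∈I others⊇ {w} w∈ {w'} w'∈ w≢w' with adj G w w' in w≁w'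
  ... | true  = refl
  ... | false = ⊥-elim (<⇒≱ larger (I-max independent))
    where
    private⇒NonAdj : ∀ {u} → u ∈ N v ─ ⋃ (map N others) → ∀ {x} → x ∈ I - v → NonAdj G u x
    private⇒NonAdj u∈ x∈ = NonAdj-sym (¬Adj⇒NonAdj λ x~u →
      x∈p─q⇒x∉q u∈ (x∈⋃ (∈N⁺ x~u) (∈-map⁺ N (others⊇ (p─q⊆p I ⁅ v ⁆ x∈) (x∉⁅y⁆⇒x≢y (x∈p─q⇒x∉q x∈))))))

    private⇒∉I : ∀ {u} → u ∈ N v ─ ⋃ (map N others) → u ∉ I
    private⇒∉I u∈ u∈I with () ← trans (sym (∈N⁻ (p─q⊆p (N v) _ u∈))) (I-independent v∈I u∈I)

    I₁ : Subset (suc m)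
    I₁ = (I - v) ∪ ⁅ w ⁆

    w'≁I₁ : ∀ {x} → x ∈ I₁ → NonAdj G w' x
    w'≁I₁ x∈ with x∈p∪q⁻ (I - v) ⁅ w ⁆ x∈
    ... | inj₁ x∈I-v = private⇒NonAdj w'∈ x∈I-v
    ... | inj₂ x∈⁅w⁆ rewrite x∈⁅y⁆⇒x≡y w x∈⁅w⁆ = NonAdj-sym w≁w'

    independent : IndependentSet (I₁ ∪ ⁅ w' ⁆)
    independent = independent-∪⁅⁆ (independent-∪⁅⁆ (independent-⊆ (p─q⊆p I ⁅ v ⁆) I-independent)
                                                      (private⇒NonAdj w∈)) w'≁I₁

    w∉I-v : w ∉ I - v
    w∉I-v = private⇒∉I w∈ ∘ p─q⊆p I ⁅ v ⁆

    w'∉I₁ : w' ∉ I₁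
    w'∉I₁ w'∈I₁ with x∈p∪q⁻ (I - v) ⁅ w ⁆ w'∈I₁
    ... | inj₁ w'∈I-v = private⇒∉I w'∈ (p─q⊆p I ⁅ v ⁆ w'∈I-v)
    ... | inj₂ w'∈⁅w⁆ = w≢w' (sym (x∈⁅y⁆⇒x≡y w w'∈⁅w⁆))

    larger : ∣ I ∣ < ∣ I₁ ∪ ⁅ w' ⁆ ∣
    larger = begin-strict
      ∣ I ∣                 ≡⟨ ∣p∣≡1+∣p-x∣ v∈I ⟩
      suc ∣ I - v ∣         <⟨ n<1+n _ ⟩
      suc (suc ∣ I - v ∣)   ≡⟨ cong suc (sym (∣p∪⁅x⁆∣≡1+∣p∣ w∉I-v)) ⟩
      suc ∣ I₁ ∣            ≡⟨ sym (∣p∪⁅x⁆∣≡1+∣p∣ w'∉I₁) ⟩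
      ∣ I₁ ∪ ⁅ w' ⁆ ∣       ∎
      where open ≤-Reasoning

  -- (A) δ ≤ ∣ I ∣ ω: the neighbourhood of v ∈ I is covered by its private
  -- part and its intersections with the neighbourhoods of the others.
  degree-bound : ∀ {v others} → v ∈ I → (∀ {x} → x ∈ I → x ≢ v → x ∈ˡ others) →
                 All (Meet≤ω v) others → δ ≤ suc (length others) * ω
  degree-bound {v} {others} v∈I others⊇ meets = begin
    δ                               ≤⟨ δ≤∣N∣ v ⟩
    ∣ N v ∣                         ≡⟨ ∣p∣≡∣p─q∣+∣p∩q∣ (N v) U ⟩
    ∣ N v ─ U ∣ + ∣ N v ∩ U ∣       ≤⟨ +-mono-≤ (ω-max (private-clique v∈I others⊇))
                                               (∣p∩⋃qs∣≤ (N v) (map N others) (All.map⁺ meets)) ⟩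
    ω + length (map N others) * ω   ≡⟨ cong (λ l → ω + l * ω) (length-map N others) ⟩
    ω + length others * ω           ∎
    where
    open ≤-Reasoning
    U = ⋃ (map N others)

  union-bound : ∀ vs → AllPairs Meet≤ω vs → length vs * δ ≤ suc m + (length vs C 2) * ω
  union-bound vs meets = subst (λ l → l * δ ≤ suc m + (l C 2) * ω) (length-map N vs) (begin
    length (map N vs) * δ                               ≤⟨ bonferroni (map N vs) (All.map⁺ (universal δ≤∣N∣ vs))
                                                                      (AllPairs.map⁺ meets) ⟩
    ∣ ⋃ (map N vs) ∣ + (length (map N vs) C 2) * ω     ≤⟨ +-monoˡ-≤ _ (∣p∣≤n (⋃ (map N vs))) ⟩
    suc m + (length (map N vs) C 2) * ω                ∎)
    where open ≤-Reasoning

  bound-from-listing : ∀ vs → AllPairs Meet≤ω vs → (∀ {x} → x ∈ I → x ∈ˡ vs) → (∀ {x} → x ∈ˡ vs → x ∈ I) →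
                       δ * δ ≤ ω * (2 * suc m + δ)
  bound-from-listing [] _ complete _ with () ← complete (enum-∈ I (fromℕ< I-nonempty))
  bound-from-listing (v ∷ others) (v-meets ∷ pairs) complete sound =
    clique-arithmetic (suc (length others)) (degree-bound (sound (Any.here refl)) others⊇ v-meets) prefix-bound
    where
    others⊇ : ∀ {x} → x ∈ I → x ≢ v → x ∈ˡ others
    others⊇ x∈I x≢v with complete x∈I
    ... | Any.here x≡v = ⊥-elim (x≢v x≡v)
    ... | Any.there x∈ = x∈

    prefix-bound : ∀ s → s ≤ suc (length others) → s * δ ≤ suc m + (s C 2) * ω
    prefix-bound s s≤ = subst (λ l → l * δ ≤ suc m + (l C 2) * ω)
      (trans (length-take s (v ∷ others)) (m≤n⇒m⊓n≡m s≤))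
      (union-bound (take s (v ∷ others)) (AllPairs.take⁺ s (v-meets ∷ pairs)))

  bound : δ * δ ≤ ω * (2 * suc m + δ)
  bound = bound-from-listing members pairs complete sound
    where
    members : List (Fin (suc m))
    members = List.tabulate (enum I)

    pairs : AllPairs Meet≤ω members
    pairs = AllPairs.tabulate⁺-< λ {i} {j} i<j →
      meet≤ω (Fin.<⇒≢ i<j ∘ enum-injective I) (I-independent (enum-∈ I i) (enum-∈ I j))

    complete : ∀ {x} → x ∈ I → x ∈ˡ members
    complete x∈ with i , refl ← enum-surjective I x∈ = ∈-tabulate⁺ i

    sound : ∀ {x} → x ∈ˡ members → x ∈ I
    sound x∈ with i , refl ← ∈-tabulate⁻ x∈ = enum-∈ I i

theorem2 : (m : ℕ) → (G : Graph (suc m)) → C4Free G →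
    Σ ℕ (λ k → HasClique G k × (minDegree G * minDegree G ≤ k * (2 * suc m + minDegree G)))
theorem2 m G c4 = ω , cliqueSet⇒HasClique K-clique , bound
  where
  open Bound G c4
  open GraphFacts G using (cliqueSet⇒HasClique)
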